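{- If $\Gamma\vdash_{SM} M:\tau$, then $|\Gamma|=sup(M)$ and, for every $1\le i\le|\Gamma|$, $\Gamma_i\neq\omega$ if and only if $\underline{i}\in FI(M)$.
   Context: Terms (de Bruijn): $M,N::=\underline{n}\mid (M\,N)\mid\lambda.M$, $n\in\mathbb{N}^*$. Free indices: $FI(\underline{n})=\{\underline{n}\}$, $FI(M_1\,M_2)=FI(M_1)\cup FI(M_2)$, $FI(\lambda.M)=\{\underline{n-1}\mid \underline{n}\in FI(M),\,n>1\}$; $sup(M)$ is the largest $n$ with $\underline{n}\in FI(M)$, and $sup(M)=0$ if $FI(M)=\emptyset$. Types: $\mathcal{A}$ is a denumerable set of type variables; $\tau,\sigma\in\mathcal{T}::=\alpha\mid u\to\tau$ and $u\in\mathcal{U}::=\omega\mid u\wedge u\mid\tau$, with $\wedge$ commutative, associative and having $\omega$ as neutral element. Contexts are lists $\Gamma::=nil\mid u.\Gamma$ with $u\in\mathcal{U}$; $\Gamma_i$ is the $i$-th element, $|\Gamma|$ the length; $\omega^{k}.\Gamma$ denotes $\Gamma$ prefixed by $k$ copies of $\omega$. Intersection of contexts: $nil\wedge\Gamma=\Gamma\wedge nil=\Gamma$, $(u_1.\Gamma)\wedge(u_2.\Delta)=(u_1\wedge u_2).(\Gamma\wedge\Delta)$. System $SM$ derives judgements $\Gamma\vdash M:\tau$ ($\tau\in\mathcal{T}$) by the rules: (var) $\tau.nil\vdash\underline{1}:\tau$; (varn) from $\Gamma\vdash\underline{n}:\tau$ infer $\omega.\Gamma\vdash\underline{n+1}:\tau$;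 ($\to_i$) from $u.\Gamma\vdash M:\tau$ infer $\Gamma\vdash\lambda.M:u\to\tau$; ($\to_i'$) from $nil\vdash M:\tau$ infer $nil\vdash\lambda.M:\omega\to\tau$; ($\to_e'$) from $\Gamma\vdash M_1:\omega\to\tau$ and $\Delta\vdash M_2:\sigma$ infer $\Gamma\wedge\Delta\vdash (M_1\,M_2):\tau$; ($\to_e$) from $\Gamma\vdash M_1:(\sigma_1\wedge\cdots\wedge\sigma_n)\to\tau$ ($n\ge1$, $\sigma_i\in\mathcal{T}$) and $\Delta^i\vdash M_2:\sigma_i$ for all $1\le i\le n$ infer $\Gamma\wedge\Delta^1\wedge\cdots\wedge\Delta^n\vdash(M_1\,M_2):\tau$. $\Gamma\vdash_{SM}M:\tau$ means this judgement is derivable in $SM$. -}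

module Defs where

open import Data.Nat using (ℕ; zero; suc; _⊔_; _<ᵇ_)
open import Data.List using (List; []; _∷_; _++_; map; filter; foldr)
open import Data.Nat using (_<?_)
open import Data.List.Relation.Binary.Permutation.Homogeneous using (Permutation)

-- de Bruijn terms.  Indices are 1-based: `var n` stands for \underline{n}
-- (n ∈ ℕ*; `var 0` is not a term of the paper, and no rule of SM types it).

data Term : Set where
  var : ℕ → Term
  app : Term → Term → Term
  lam : Term → Term

FI : Term → List ℕ
FI (var n)   = n ∷ []
FI (app M N) = FI M ++ FI N
FI (lam M)   = map pred' (filter (1 <?_) (FI M))
  where
  pred' : ℕ → ℕ
  pred' zero    = zero
  pred' (suc n) = n

sup : Term → ℕ
sup M = foldr _⊔_ 0 (FI M)

-- An element of U is a finite intersection σ₁ ∧ … ∧ σₙ of types,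
-- represented as the list [σ₁,…,σₙ]; ω is [] and ∧ is _++_.
-- Commutativity/associativity/neutrality of ∧ is accounted for by the
-- equivalence _≈T_ / _≈U_ below (lists up to permutation, recursively).

data Ty : Set where
  tvar : ℕ → Ty
  _⇒_  : List Ty → Ty → Ty

U : Set
U = List Ty

ω : U
ω = []

_∧_ : U → U → U
_∧_ = _++_

mutual
  data _≈T_ : Ty → Ty → Set where
    tvar : ∀ {a} → tvar a ≈T tvar a
    arr  : ∀ {u v τ σ} → u ≈U v → τ ≈T σ → (u ⇒ τ) ≈T (v ⇒ σ)

  data _≈U_ : U → U → Set where
    perm : ∀ {u v} → Permutation _≈T_ u v → u ≈U v

-- Contexts: lists of elements of U; Γ_i is the i-th element (1-based).

Ctx : Set
Ctx = List U

_∧c_ : Ctx → Ctx → Ctx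
[]       ∧c Δ        = Δ
(u ∷ Γ)  ∧c []       = u ∷ Γ
(u ∷ Γ)  ∧c (v ∷ Δ)  = (u ∧ v) ∷ (Γ ∧c Δ)

infix 4 _⊢_∶_

mutual
  data _⊢_∶_ : Ctx → Term → Ty → Set where
    var   : ∀ {τ} → ((τ ∷ []) ∷ []) ⊢ var 1 ∶ τ
    varn  : ∀ {Γ n τ} → Γ ⊢ var n ∶ τ → (ω ∷ Γ) ⊢ var (suc n) ∶ τ
    →i    : ∀ {u Γ M τ} → (u ∷ Γ) ⊢ M ∶ τ → Γ ⊢ lam M ∶ (u ⇒ τ)
    →i′   : ∀ {M τ} → [] ⊢ M ∶ τ → [] ⊢ lam M ∶ (ω ⇒ τ)
    →e′   : ∀ {Γ Δ M₁ M₂ τ σ} → Γ ⊢ M₁ ∶ (ω ⇒ τ) → Δ ⊢ M₂ ∶ σ →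
            (Γ ∧c Δ) ⊢ app M₁ M₂ ∶ τ
    -- u is (up to AC) the intersection σ₁ ∧ ⋯ ∧ σₙ, n ≥ 1, and the
    -- premises Δⁱ ⊢ M₂ : σᵢ are collected in `Args` with Δ = Δ¹ ∧ ⋯ ∧ Δⁿ
    →e    : ∀ {Γ Δ M₁ M₂ u σs τ} → Γ ⊢ M₁ ∶ (u ⇒ τ) → u ≈U σs →
            Args M₂ σs Δ → (Γ ∧c Δ) ⊢ app M₁ M₂ ∶ τ

  data Args (M : Term) : List Ty → Ctx → Set where
    one  : ∀ {Δ σ} → Δ ⊢ M ∶ σ → Args M (σ ∷ []) Δ
    more : ∀ {Δ Δ′ σ σs} → Δ ⊢ M ∶ σ → Args M σs Δ′ → Args M (σ ∷ σs) (Δ ∧c Δ′)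

-- A derivation places non-ω entries of its context exactly at the free
-- indices of its subject: the axiom puts its type at position n of a
-- context of length n, an abstraction drops position 1 and shifts the rest
-- down, and an application intersects the contexts of its premises
-- pointwise while taking the union of their free indices.  Every rule of SM
-- thus preserves the invariant Tight below.
module Submission where

open import Defs
open import Data.Nat using (ℕ; zero; suc; pred; _⊔_; _<?_; s≤s; z≤n)
open import Data.Nat.Properties using (⊔-assoc; ⊔-idem; ⊔-identityʳ)
open import Data.Fin using (Fin; toℕ)
open import Data.List using (List; []; _∷_; _++_; length; lookup; map; filter; foldr; drop)
open import Data.List.Properties using (map-cong; ++-identityʳ)
open import Data.List.Membership.Propositional using (_∈_; _∉_)
open import Data.List.Membership.Propositional.Properties
  using (++-∈⇔; ∈-++⁺ˡ; ∈-++⁻; ∈-map∘filter⁺; ∈-map∘filter⁻)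
open import Data.List.Relation.Unary.Any using (here)
open import Data.Product using (_×_; _,_)
open import Data.Sum using (_⊎_; inj₁; inj₂; [_,_])
open import Data.Sum.Function.Propositional using (_⊎-⇔_)
open import Data.Empty using (⊥-elim)
open import Function using (id; _∘_)
open import Function.Bundles using (_⇔_; mk⇔; Equivalence)
open import Function.Properties.Equivalence using () renaming (sym to ⇔-sym; trans to ⇔-trans)
open import Relation.Binary.PropositionalEquality using (_≡_; _≢_; refl; cong; cong₂; sym; trans; subst)

open Equivalence using (to; from)

max : List ℕ → ℕ
max = foldr _⊔_ 0

max-++ : ∀ xs ys → max (xs ++ ys) ≡ max xs ⊔ max ys
max-++ []       ys = refl
max-++ (x ∷ xs) ys = trans (cong (x ⊔_) (max-++ xs ys)) (sym (⊔-assoc x (max xs) (max ys)))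

unbind : List ℕ → List ℕ
unbind L = map pred (filter (1 <?_) L)

FI-lam : ∀ M → FI (lam M) ≡ unbind (FI M)
FI-lam M = map-cong (λ { zero → refl ; (suc n) → refl }) (filter (1 <?_) (FI M))

max-unbind : ∀ L → max (unbind L) ≡ pred (max L)
max-unbind []                = refl
max-unbind (zero ∷ L)        = max-unbind L
max-unbind (suc zero ∷ L)    = trans (max-unbind L) (pred-1⊔ (max L))
  where
  pred-1⊔ : ∀ n → pred n ≡ pred (1 ⊔ n)
  pred-1⊔ zero    = refl
  pred-1⊔ (suc n) = refl
max-unbind (suc (suc x) ∷ L) = trans (cong (suc x ⊔_) (max-unbind L)) (pred-⊔ (max L))
  where
  pred-⊔ : ∀ n → suc x ⊔ pred n ≡ pred (suc (suc x) ⊔ n)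
  pred-⊔ zero    = refl
  pred-⊔ (suc n) = refl

0∉unbind : ∀ L → 0 ∉ unbind L
0∉unbind L p with ∈-map∘filter⁻ pred (1 <?_) {xs = L} p
... | _ , _ , () , s≤s (s≤s _)

suc∈unbind⇔ : ∀ {k} L → (suc k ∈ unbind L) ⇔ (suc (suc k) ∈ L)
suc∈unbind⇔ L = mk⇔ to′ (λ p → ∈-map∘filter⁺ pred (1 <?_) {xs = L} (_ , p , refl , s≤s (s≤s z≤n)))
  where
  to′ : ∀ {k L} → suc k ∈ unbind L → suc (suc k) ∈ L
  to′ {L = L} p with ∈-map∘filter⁻ pred (1 <?_) {xs = L} p
  ... | _ , p′ , refl , s≤s (s≤s _) = p′

-- Γ at the 1-based position m, with ω outside 1 … length Γ.
entry : Ctx → ℕ → U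
entry Γ       zero          = ω
entry []      (suc m)       = ω
entry (u ∷ Γ) (suc zero)    = u
entry (u ∷ Γ) (suc (suc m)) = entry Γ (suc m)

entry-lookup : ∀ Γ (i : Fin (length Γ)) → entry Γ (suc (toℕ i)) ≡ lookup Γ i
entry-lookup (u ∷ Γ) Fin.zero    = refl
entry-lookup (u ∷ Γ) (Fin.suc i) = entry-lookup Γ i

entry-∧c : ∀ Γ Δ m → entry (Γ ∧c Δ) m ≡ entry Γ m ∧ entry Δ m
entry-∧c Γ       Δ       zero          = refl
entry-∧c []      Δ       (suc m)       = refl
entry-∧c (u ∷ Γ) []      (suc zero)    = sym (++-identityʳ u)
entry-∧c (u ∷ Γ) []      (suc (suc m)) = sym (++-identityʳ (entry Γ (suc m)))
entry-∧c (u ∷ Γ) (v ∷ Δ) (suc zero)    = refl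
entry-∧c (u ∷ Γ) (v ∷ Δ) (suc (suc m)) = entry-∧c Γ Δ (suc m)

length-∧c : ∀ Γ Δ → length (Γ ∧c Δ) ≡ length Γ ⊔ length Δ
length-∧c []      Δ       = refl
length-∧c (u ∷ Γ) []      = refl
length-∧c (u ∷ Γ) (v ∷ Δ) = cong suc (length-∧c Γ Δ)

≢ω-cong : ∀ {u v} → u ≡ v → (u ≢ ω) ⇔ (v ≢ ω)
≢ω-cong refl = mk⇔ id id

∧-≢ω⇔ : ∀ u v → (u ∧ v ≢ ω) ⇔ (u ≢ ω ⊎ v ≢ ω)
∧-≢ω⇔ []      v = mk⇔ inj₂ [ (λ u≢ω → ⊥-elim (u≢ω refl)) , id ]
∧-≢ω⇔ (σ ∷ u) v = mk⇔ (λ _ → inj₁ (λ ())) (λ _ ())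

record Tight (Γ : Ctx) (L : List ℕ) : Set where
  field
    length≡max : length Γ ≡ max L
    ≢ω⇔∈      : ∀ m → (entry Γ m ≢ ω) ⇔ (m ∈ L)
open Tight

tight-var : ∀ τ → Tight ((τ ∷ []) ∷ []) (1 ∷ [])
tight-var τ = record { length≡max = refl ; ≢ω⇔∈ = λ
  { zero          → mk⇔ (λ ω≢ω → ⊥-elim (ω≢ω refl)) (λ { (here ()) })
  ; (suc zero)    → mk⇔ (λ _ → here refl) (λ _ ())
  ; (suc (suc m)) → mk⇔ (λ ω≢ω → ⊥-elim (ω≢ω refl)) (λ { (here ()) }) } }

tight-varn : ∀ {Γ n} → Tight Γ (n ∷ []) → Tight (ω ∷ Γ) (suc n ∷ [])
tight-varn {Γ} {n} t = record
  { length≡max = cong suc (trans (length≡max t) (⊔-identityʳ n))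
  ; ≢ω⇔∈ = λ
    { zero          → mk⇔ (λ ω≢ω → ⊥-elim (ω≢ω refl)) (λ { (here ()) })
    ; (suc zero)    → mk⇔ (λ ω≢ω → ⊥-elim (ω≢ω refl))
                          (λ { (here refl) → ⊥-elim (from (≢ω⇔∈ t 0) (here refl) refl) })
    ; (suc (suc m)) → mk⇔ (λ p → suc∈ (to (≢ω⇔∈ t (suc m)) p))
                          (λ { (here refl) → from (≢ω⇔∈ t (suc m)) (here refl) }) } }
  where
  suc∈ : ∀ {k} → k ∈ n ∷ [] → suc k ∈ suc n ∷ []
  suc∈ (here refl) = here refl

length-drop₁ : ∀ (Γ : Ctx) → length (drop 1 Γ) ≡ pred (length Γ)
length-drop₁ []      = refl
length-drop₁ (u ∷ Γ) = refl

entry-drop₁ : ∀ Γ m → entry (drop 1 Γ) (suc m) ≡ entry Γ (suc (suc m))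
entry-drop₁ []      m = refl
entry-drop₁ (u ∷ Γ) m = refl

-- drop 1 serves both abstraction rules: it strips u from u ∷ Γ and fixes [].
tight-drop₁ : ∀ {Γ L} → Tight Γ L → Tight (drop 1 Γ) (unbind L)
tight-drop₁ {Γ} {L} t = record
  { length≡max = trans (length-drop₁ Γ) (trans (cong pred (length≡max t)) (sym (max-unbind L)))
  ; ≢ω⇔∈ = λ
    { zero    → mk⇔ (λ ω≢ω → ⊥-elim (ω≢ω refl)) (λ p → ⊥-elim (0∉unbind L p))
    ; (suc m) → ⇔-trans (≢ω-cong (entry-drop₁ Γ m))
               (⇔-trans (≢ω⇔∈ t (suc (suc m))) (⇔-sym (suc∈unbind⇔ L))) } }

tight-∧c : ∀ {Γ Δ L₁ L₂} → Tight Γ L₁ → Tight Δ L₂ → Tight (Γ ∧c Δ) (L₁ ++ L₂)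
tight-∧c {Γ} {Δ} {L₁} {L₂} t s = record
  { length≡max = trans (length-∧c Γ Δ) (trans (cong₂ _⊔_ (length≡max t) (length≡max s)) (sym (max-++ L₁ L₂)))
  ; ≢ω⇔∈ = λ m →
      ⇔-trans (≢ω-cong (entry-∧c Γ Δ m))
     (⇔-trans (∧-≢ω⇔ (entry Γ m) (entry Δ m))
     (⇔-trans (≢ω⇔∈ t m ⊎-⇔ ≢ω⇔∈ s m)
              (⇔-sym ++-∈⇔)))
  }

tight-dedup : ∀ {Γ L} → Tight Γ (L ++ L) → Tight Γ L
tight-dedup {Γ} {L} t = record
  { length≡max = trans (length≡max t) (trans (max-++ L L) (⊔-idem (max L)))
  ; ≢ω⇔∈ = λ m → ⇔-trans (≢ω⇔∈ t m) (mk⇔ ([ id , id ] ∘ ∈-++⁻ L) ∈-++⁺ˡ)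
  }

mutual
  tight : ∀ {Γ M τ} → Γ ⊢ M ∶ τ → Tight Γ (FI M)
  tight var            = tight-var _
  tight (varn d)       = tight-varn (tight d)
  tight (→i {M = M} d) = subst (Tight _) (sym (FI-lam M)) (tight-drop₁ (tight d))
  tight (→i′ {M} d)    = subst (Tight _) (sym (FI-lam M)) (tight-drop₁ (tight d))
  tight (→e′ d₁ d₂)    = tight-∧c (tight d₁) (tight d₂)
  tight (→e d₁ _ ds)   = tight-∧c (tight d₁) (tight-args ds)

  tight-args : ∀ {M σs Δ} → Args M σs Δ → Tight Δ (FI M)
  tight-args (one d)     = tight d
  tight-args (more d ds) = tight-dedup (tight-∧c (tight d) (tight-args ds))

lemma2p4 : ∀ {Γ : Ctx} {M : Term} {τ : Ty} → Γ ⊢ M ∶ τ →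
    (length Γ ≡ sup M) ×
    ((i : Fin (length Γ)) → (lookup Γ i ≢ ω) ⇔ (suc (toℕ i) ∈ FI M))
lemma2p4 {Γ} {M} d =
  length≡max t , λ i → ⇔-trans (≢ω-cong (sym (entry-lookup Γ i))) (≢ω⇔∈ t (suc (toℕ i)))
  where
  t : Tight Γ (FI M)
  t = tight d
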